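{- Let $g$ be a positive integer and $S$ a numerical semigroup of genus $g$ with $h(S)=0$. Then $S$ has no children in the ordinarization tree $\mathcal{T}_g$.
   Context: For a numerical semigroup $S$ (additive submonoid of $\mathbb{N}_0$ with finite complement), $F(S)$ is the largest gap, $m(S)$ the smallest nonzero element. $S_g=\{0,g+1,g+2,\ldots\}$. A numerical semigroup $S'\neq S_g$ of genus $g$ is a child of $S$ in $\mathcal{T}_g$ if $S'\cup\{F(S')\}\setminus\{m(S')\}=S$. The effective generators of $S$ are its minimal generators larger than $F(S)$, and $h(S)$ is their number. -}

module Defs where

open import Data.Nat using (ℕ; zero; suc; _+_; _≤_; _<_)
open import Data.Bool using (Bool; true; false; if_then_else_)
open import Data.Product using (Σ; _×_; ∃; ∃-syntax)
open import Data.Sum using (_⊎_)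
open import Relation.Nullary using (¬_)
open import Relation.Binary.PropositionalEquality using (_≡_; _≢_)

record NumericalSemigroup : Set where
  field
    mem     : ℕ → Bool
    zero∈   : mem 0 ≡ true
    closed  : ∀ a b → mem a ≡ true → mem b ≡ true → mem (a + b) ≡ true
    cofinite : ∃[ N ] (∀ n → N ≤ n → mem n ≡ true)
open NumericalSemigroup public

_∈S_ : ℕ → NumericalSemigroup → Set
n ∈S S = mem S n ≡ true

_∉S_ : ℕ → NumericalSemigroup → Set
n ∉S S = mem S n ≡ false

gapsBelow : NumericalSemigroup → ℕ → ℕ
gapsBelow S zero = 0
gapsBelow S (suc N) = gapsBelow S N + (if mem S N then 0 else 1)

HasGenus : NumericalSemigroup → ℕ → Set
HasGenus S g = ∃[ N ] ((∀ n → N ≤ n → n ∈S S) × gapsBelow S N ≡ g)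

IsFrobenius : NumericalSemigroup → ℕ → Set
IsFrobenius S F = F ∉S S × (∀ n → F < n → n ∈S S)

IsMultiplicity : NumericalSemigroup → ℕ → Set
IsMultiplicity S m = 0 < m × m ∈S S × (∀ k → 0 < k → k < m → k ∉S S)

IsOrdinary : NumericalSemigroup → ℕ → Set
IsOrdinary S g = ∀ n → (n ∈S S → (n ≡ 0 ⊎ g < n)) × ((n ≡ 0 ⊎ g < n) → n ∈S S)

IsMinimalGenerator : NumericalSemigroup → ℕ → Set
IsMinimalGenerator S x =
  0 < x × x ∈S S ×
  ¬ (∃[ a ] ∃[ b ] (0 < a × 0 < b × a ∈S S × b ∈S S × a + b ≡ x))

IsEffectiveGenerator : NumericalSemigroup → ℕ → Set
IsEffectiveGenerator S x = Σ ℕ λ F → IsFrobenius S F × F < x × IsMinimalGenerator S x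

HZero : NumericalSemigroup → Set
HZero S = ∀ x → ¬ IsEffectiveGenerator S x

IsChild : ℕ → NumericalSemigroup → NumericalSemigroup → Set
IsChild g S S' =
  HasGenus S' g × ¬ IsOrdinary S' g ×
  Σ ℕ λ F' → Σ ℕ λ m' → IsFrobenius S' F' × IsMultiplicity S' m' ×
    (∀ n → (n ∈S S → ((n ∈S S' ⊎ n ≡ F') × n ≢ m'))
         × (((n ∈S S' ⊎ n ≡ F') × n ≢ m') → n ∈S S))

-- If m' < F', then F' lies in S = S' ∪ {F'} ∖ {m'}, everything above F' lies in S, and the gap m'
-- shows F(S) < F'; moreover F' cannot be a sum of two smaller elements of S, since these would lie
-- in S' and then so would F'. Hence F' is an effective generator of S, contradicting h(S) = 0.
-- If F' < m', then S' = {0} ∪ (F', ∞) is ordinary of genus F' = g, so it is S_g, which has no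
-- place in the tree. And m' = F' is impossible since m' ∈ S' ∌ F'.
module Submission where

open import Defs
open import Data.Nat using (ℕ; zero; suc; _+_; _∸_; _⊔_; _≤_; _<_; _≤′_; ≤′-refl; ≤′-step; z≤n; s≤s; z<s)
open import Data.Nat.Properties
open import Data.Bool using (true; false; if_then_else_)
open import Data.Bool.Properties using (not-¬; ¬-not)
open import Data.Product using (Σ; _×_; _,_; proj₁; proj₂; ∃-syntax)
open import Data.Sum using (_⊎_; inj₁; inj₂)
open import Data.Empty using (⊥-elim)
open import Relation.Nullary using (¬_; yes; no)
open import Relation.Binary using (tri<; tri≈; tri>)
open import Relation.Binary.PropositionalEquality

private variable
  S S' : NumericalSemigroup
  j k n F F' m m' g N : ℕ

frobenius-of-gap : j < k → j ∉S S → (∀ n → k ≤ n → n ∈S S) → Σ ℕ λ F → IsFrobenius S F × F < k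
frobenius-of-gap {k = suc k} {S} j<1+k j∉S above with mem S k in k∈?S
... | false = k , (k∈?S , λ n k<n → above n k<n) , ≤-refl
... | true with m≤n⇒m<n∨m≡n (≤-pred j<1+k)
...   | inj₂ refl = ⊥-elim (not-¬ k∈?S j∉S)
...   | inj₁ j<k with frobenius-of-gap {S = S} j<k j∉S above′
  where
  above′ : ∀ n → k ≤ n → n ∈S S
  above′ n k≤n with m≤n⇒m<n∨m≡n k≤n
  ... | inj₁ k<n = above n k<n
  ... | inj₂ refl = k∈?S
...     | F , frobenius , F<k = F , frobenius , m<n⇒m<1+n F<k

Decomposable : NumericalSemigroup → ℕ → Set
Decomposable S x = ∃[ a ] ∃[ b ] (0 < a × 0 < b × a ∈S S × b ∈S S × a + b ≡ x)

¬decomposable-of-gap-above : n ∉S S' → (∀ a → a < n → a ∈S S → a ∈S S') → ¬ Decomposable S n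
¬decomposable-of-gap-above {S' = S'} n∉S' below (a , b , 0<a , 0<b , a∈S , b∈S , refl) =
  not-¬ (closed S' a b (below a (m<m+n a 0<b) a∈S) (below b (m<n+m b 0<a) b∈S)) n∉S'

OrdinarizationTransform : NumericalSemigroup → ℕ → ℕ → NumericalSemigroup → Set
OrdinarizationTransform S' F' m' S =
  ∀ n → (n ∈S S → ((n ∈S S' ⊎ n ≡ F') × n ≢ m'))
      × (((n ∈S S' ⊎ n ≡ F') × n ≢ m') → n ∈S S)

module _ (T : OrdinarizationTransform S' F' m' S) where

  transform-keeps : n ∈S S' → n ≢ m' → n ∈S S
  transform-keeps {n} n∈S' n≢m' = proj₂ (T n) (inj₁ n∈S' , n≢m')

  transform-adds : F' ≢ m' → F' ∈S S
  transform-adds F'≢m' = proj₂ (T F') (inj₂ refl , F'≢m')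

  transform-removes : m' ∉S S
  transform-removes = ¬-not λ m'∈S → proj₂ (proj₁ (T m') m'∈S) refl

  transform-within : n ∈S S → n ≢ F' → n ∈S S'
  transform-within {n} n∈S n≢F' with proj₁ (proj₁ (T n) n∈S)
  ... | inj₁ n∈S' = n∈S'
  ... | inj₂ n≡F' = ⊥-elim (n≢F' n≡F')

  transform-isEffectiveGenerator : IsFrobenius S' F' → m' < F' → IsEffectiveGenerator S F'
  transform-isEffectiveGenerator (F'∉S' , aboveF') m'<F' =
    let F , frobenius , F<F' = frobenius-of-gap {S = S} m'<F' transform-removes fromF'
    in  F , frobenius , F<F' , (≤-<-trans z≤n m'<F' , F'∈S , ¬decomposable)
    where
    F'∈S : F' ∈S S
    F'∈S = transform-adds (>⇒≢ m'<F')

    fromF' : ∀ n → F' ≤ n → n ∈S S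
    fromF' n F'≤n with m≤n⇒m<n∨m≡n F'≤n
    ... | inj₁ F'<n = transform-keeps (aboveF' n F'<n) (>⇒≢ (<-trans m'<F' F'<n))
    ... | inj₂ refl = F'∈S

    ¬decomposable : ¬ Decomposable S F'
    ¬decomposable = ¬decomposable-of-gap-above {S' = S'} {S = S} F'∉S'
                      λ a a<F' a∈S → transform-within a∈S (<⇒≢ a<F')

isOrdinary-of-frobenius<multiplicity : IsFrobenius S F → IsMultiplicity S m → F < m → IsOrdinary S F
isOrdinary-of-frobenius<multiplicity {S} {F} (_ , aboveF) (_ , _ , belowM) F<m n = into n , aboveF′ n
  where
  into : ∀ n → n ∈S S → n ≡ 0 ⊎ F < n
  into zero    _   = inj₁ refl
  into (suc n) n∈S with F <? suc n
  ... | yes F<n = inj₂ F<n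
  ... | no  F≮n = ⊥-elim (not-¬ n∈S (belowM (suc n) z<s (<-≤-trans (s≤s (≮⇒≥ F≮n)) F<m)))

  aboveF′ : ∀ n → n ≡ 0 ⊎ F < n → n ∈S S
  aboveF′ .0 (inj₁ refl) = zero∈ S
  aboveF′ n  (inj₂ F<n)  = aboveF n F<n

ordinary-gap : IsOrdinary S F → 0 < n → n ≤ F → n ∉S S
ordinary-gap {S} {F} {n} ordinary 0<n n≤F = ¬-not λ n∈S → excluded (proj₁ (ordinary n) n∈S)
  where
  excluded : ¬ (n ≡ 0 ⊎ F < n)
  excluded (inj₁ refl) = <-irrefl refl 0<n
  excluded (inj₂ F<n)  = <⇒≱ F<n n≤F

gapsBelow-ordinary : IsOrdinary S F → k ≤ suc F → gapsBelow S k ≡ k ∸ 1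
gapsBelow-ordinary {k = zero} _ _ = refl
gapsBelow-ordinary {S} {k = suc zero} _ _ rewrite zero∈ S = refl
gapsBelow-ordinary {S} {k = suc (suc j)} ordinary (s≤s 1+j≤F)
  = trans (cong₂ (λ gaps b → gaps + (if b then 0 else 1))
                 (gapsBelow-ordinary {S} ordinary (m≤n⇒m≤1+n 1+j≤F)) (ordinary-gap {S} ordinary z<s 1+j≤F))
          (+-comm j 1)

gapsBelow-stable : (∀ n → N ≤ n → n ∈S S) → N ≤′ k → gapsBelow S k ≡ gapsBelow S N
gapsBelow-stable conductor ≤′-refl = refl
gapsBelow-stable conductor (≤′-step {k} N≤′k)
  rewrite conductor k (≤′⇒≤ N≤′k) = trans (+-identityʳ _) (gapsBelow-stable conductor N≤′k)

genus-ordinary : IsOrdinary S F → HasGenus S g → g ≡ F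
genus-ordinary {S} {F} {g} ordinary (N , conductor , gapsBelowN) = begin
  g                         ≡⟨ sym gapsBelowN ⟩
  gapsBelow S N             ≡⟨ sym (gapsBelow-stable conductor (≤⇒≤′ (m≤m⊔n N (suc F)))) ⟩
  gapsBelow S (N ⊔ suc F)   ≡⟨ gapsBelow-stable aboveF (≤⇒≤′ (m≤n⊔m N (suc F))) ⟩
  gapsBelow S (suc F)       ≡⟨ gapsBelow-ordinary ordinary ≤-refl ⟩
  F                         ∎
  where
  open ≡-Reasoning
  aboveF : ∀ n → suc F ≤ n → n ∈S S
  aboveF n F<n = proj₂ (ordinary n) (inj₂ F<n)

mainTheorem8 : (g : ℕ) → 0 < g → (S : NumericalSemigroup) → HasGenus S g →
    HZero S → (S' : NumericalSemigroup) → ¬ IsChild g S S'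
mainTheorem8 g _ S _ hZero S' (genus' , notOrdinary , F' , m' , frobenius' , multiplicity' , T)
  with <-cmp m' F'
... | tri< m'<F' _ _ = hZero F' (transform-isEffectiveGenerator {S' = S'} {S = S} T frobenius' m'<F')
... | tri≈ _ refl _ = not-¬ (proj₁ (proj₂ multiplicity')) (proj₁ frobenius')
... | tri> _ _ F'<m' = notOrdinary (subst (IsOrdinary S') (sym (genus-ordinary ordinary genus')) ordinary)
  where
  ordinary : IsOrdinary S' F'
  ordinary = isOrdinary-of-frobenius<multiplicity {S'} frobenius' multiplicity' F'<m'
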